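{- Let $\mathfrak{g}$ and $\widehat{\mathfrak{g}}$ be symmetrizable Kac–Moody algebras with index sets $I$ and $\widehat{I}$, generalized Cartan matrices $C=(C_{ij})_{i,j\in I}$ and $\widehat{C}=(\widehat{C}_{i'j'})_{i',j'\in\widehat{I}}$. Let $\phi\colon \widehat{I}\to I$ be a surjection with $\widehat{C}_{i_1'i_2'}=0$ whenever $i_1'\neq i_2'$ lie in the same fiber $\phi^{ -1}(i)$, and let $(\gamma_i\in\mathbb{Z}_{>0}\colon i\in I)$ be scaling factors. Let $\mathbf{c}=(c_{ij})_{i\neq j}$ and $\widehat{\mathbf{c}}=(\widehat{c}_{i'j'})_{i'\neq j'}$ be integer arrays with $c_{ij}+c_{ji}=1$ and $\widehat{c}_{i'j'}+\widehat{c}_{j'i'}=1$, and assume $\widehat{\mathbf{c}}$ is compatible with $\mathbf{c}$, i.e. $\widehat{c}_{i'j'}=c_{ij}$ for all $i'\in\phi^{ -1}(i)$, $j'\in\phi^{ -1}(j)$ with $i'\sim j'$ and $i\sim j$. Let $v$ be the multiplicative map on monomials defined by $v(Y_{i,k})=\prod_{i'\in\phi^{ -1}(i)}\widehat{Y}_{i',k}^{\gamma_i}$. Suppose that $\widetilde{\phi}(\alpha_i)=\sum_{i'\in\phi^{ -1}(i)}\gamma_i\widehat{\alpha}_{i'}$ for all $i\in I$. Then for all $i\in I$ and $k\in\mathbb{Z}_{\ge 0}$, $$v(A_{i,k})=\prod_{i'\in\phi^{ -1}(i)}\widehat{A}_{i',k}^{\gamma_i}.$$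
   Context: For a symmetrizable Kac–Moody algebra with index set $I$ and generalized Cartan matrix $C$, $\Lambda_i$ are the fundamental weights, $\alpha_i$ the simple roots, and in $\mathbb{Q}\otimes P$ one identifies $\alpha_i=\sum_{j\in I}C_{ji}\Lambda_j$. Write $i\sim j$ if $i\neq j$ and $C_{ij}\neq 0$. Monomials are products of commuting variables $Y_{i,k}$ ($i\in I$, $k\in\mathbb{Z}$) and their inverses; given an array $\mathbf{c}$, $A_{i,k}=Y_{i,k}Y_{i,k+1}\prod_{j\neq i}Y_{j,k+c_{ji}}^{C_{ji}}$. The same definitions with hats (variables $\widehat{Y}_{i',k}$, array $\widehat{\mathbf{c}}$, matrix $\widehat{C}$) define $\widehat{A}_{i',k}$ for $\widehat{\mathfrak{g}}$. The map $\widetilde{\phi}$ from the weight lattice of $\mathfrak{g}$ to that of $\widehat{\mathfrak{g}}$ is the linear map with $\widetilde{\phi}(\Lambda_i)=\gamma_i\sum_{i'\in\phi^{ -1}(i)}\widehat{\Lambda}_{i'}$. -}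

module Defs where

open import Data.Nat as ℕ using (ℕ; zero; suc)
open import Data.Integer using (ℤ; +_; 0ℤ; _+_; _*_; _≤_)
open import Data.Fin using (Fin; zero; suc; _≟_)
import Data.Integer as ℤ
open import Data.Product using (Σ; ∃; _×_)
open import Relation.Nullary using (Dec; yes; no; ¬_)
open import Relation.Binary.PropositionalEquality using (_≡_; _≢_)

record IsGCM {n : ℕ} (C : Fin n → Fin n → ℤ) : Set where
  field
    diag    : ∀ i → C i i ≡ + 2
    offdiag : ∀ i j → i ≢ j → C i j ≤ 0ℤ
    zeroSym : ∀ i j → C i j ≡ 0ℤ → C j i ≡ 0ℤ

Symmetrizable : {n : ℕ} → (Fin n → Fin n → ℤ) → Set
Symmetrizable {n} C =
  Σ (Fin n → ℕ) λ d → (∀ i → 0 ℕ.< d i) × (∀ i j → + d i * C i j ≡ + d j * C j i)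

IsSymGCM : {n : ℕ} → (Fin n → Fin n → ℤ) → Set
IsSymGCM C = IsGCM C × Symmetrizable C

_∼[_]_ : {n : ℕ} → Fin n → (Fin n → Fin n → ℤ) → Fin n → Set
i ∼[ C ] j = (i ≢ j) × (C i j ≢ 0ℤ)

IsArray : {n : ℕ} → (Fin n → Fin n → ℤ) → Set
IsArray {n} c = ∀ (i j : Fin n) → i ≢ j → c i j + c j i ≡ + 1

ind : {P : Set} → Dec P → ℤ
ind (yes _) = + 1
ind (no _)  = 0ℤ

sumFin : (m : ℕ) → (Fin m → ℤ) → ℤ
sumFin zero    f = 0ℤ
sumFin (suc m) f = f zero + sumFin m (λ x → f (suc x))

sumFiber : {n m : ℕ} → (Fin m → Fin n) → Fin n → (Fin m → ℤ) → ℤ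
sumFiber {n} {m} φ i f = sumFin m (λ i' → ind (φ i' ≟ i) * f i')

-- Laurent monomials in Y_{i,k}: exponent function (i , k) ↦ exponent.
-- Product of monomials = pointwise sum, power = scaling; equality pointwise.
Mono : ℕ → Set
Mono n = Fin n → ℤ → ℤ

_≈M_ : {n : ℕ} → Mono n → Mono n → Set
M ≈M N = ∀ j l → M j l ≡ N j l

-- A_{i,k} = Y_{i,k} Y_{i,k+1} ∏_{j≠i} Y_{j,k+c_ji}^{C_ji}
A : {n : ℕ} → (C c : Fin n → Fin n → ℤ) → Fin n → ℤ → Mono n
A C c i k j l with j ≟ i
... | yes _ = ind (l ℤ.≟ k) + ind (l ℤ.≟ (k + + 1))
... | no _  = ind (l ℤ.≟ (k + c j i)) * C j i

v : {n m : ℕ} → (Fin m → Fin n) → (Fin n → ℕ) → Mono n → Mono m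
v φ γ M i' l = + γ (φ i') * M (φ i') l

fiberProdA : {n m : ℕ} → (Fin m → Fin n) → (Fin n → ℕ) →
             (Ĉ ĉ : Fin m → Fin m → ℤ) → Fin n → ℤ → Mono m
fiberProdA φ γ Ĉ ĉ i k j' l = sumFiber φ i (λ i' → + γ i * A Ĉ ĉ i' k j' l)

-- Weights in the span of fundamental weights, as coefficient vectors
-- w = Σ_j w(j) Λ_j.
Wt : ℕ → Set
Wt n = Fin n → ℤ

α : {n : ℕ} → (Fin n → Fin n → ℤ) → Fin n → Wt n
α C i j = C j i

-- φ̃ linear with φ̃(Λ_i) = γ_i Σ_{i'∈φ⁻¹(i)} Λ̂_{i'}
φ̃ : {n m : ℕ} → (Fin m → Fin n) → (Fin n → ℕ) → Wt n → Wt m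
φ̃ φ γ w j' = + γ (φ j') * w (φ j')

-- Both sides are compared coefficientwise at Ŷ_{j',l}. If φ j' = i, only
-- Â_{j',k} contributes, since Ĉ vanishes between distinct points of a fiber,
-- and both sides are γ_i (Ŷ_{j',k} Ŷ_{j',k+1}). If φ j' ≠ i, the weight
-- hypothesis says γ_{φ j'} C_{φ j' i} = Σ_{i' ∈ φ⁻¹(i)} γ_i Ĉ_{j' i'}; as the
-- summands are ≤ 0, C_{φ j' i} = 0 forces every Ĉ_{j' i'} to vanish, so each
-- nonzero Ĉ_{j' i'} makes j' ∼ i' and φ j' ∼ i adjacent, and compatibility
-- puts all of them at the same shift ĉ_{j' i'} = c_{φ j' i}.
module Submission where

open import Defs
open import Data.Nat using (ℕ; _<_)
open import Data.Integer using (ℤ; +_; _*_)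
open import Data.Fin using (Fin)
open import Data.Product using (∃; _×_)
open import Relation.Binary.PropositionalEquality using (_≡_; _≢_)

import Data.Nat as ℕ
import Data.Nat.Properties as ℕ
open import Data.Integer using (0ℤ; _+_; _≤_)
import Data.Integer as ℤ
open import Data.Integer.Properties hiding (_≟_)
open import Data.Fin using (zero; suc; _≟_)
import Data.Fin.Properties as Fin
open import Data.Product using (_,_)
open import Data.Sum using (inj₁; inj₂)
open import Data.Empty using (⊥-elim)
open import Relation.Nullary using (Dec; yes; no)
open import Function using (_∘_)
open import Algebra.Properties.CommutativeSemigroup *-commutativeSemigroup using (x∙yz≈y∙xz)
open import Relation.Binary.PropositionalEquality
  using (refl; sym; trans; cong; cong₂; subst; module ≡-Reasoning)

open ≡-Reasoning

+-nonPos-zeroˡ : ∀ {a b} → a ≤ 0ℤ → b ≤ 0ℤ → a + b ≡ 0ℤ → a ≡ 0ℤ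
+-nonPos-zeroˡ {a} {b} a≤0 b≤0 a+b≡0 =
  ≤-antisym a≤0 (subst (_≤ a) a+b≡0 (subst (a + b ≤_) (+-identityʳ a) (+-monoʳ-≤ a b≤0)))

+n*j≡0⇒j≡0 : ∀ {g} j → 0 < g → + g * j ≡ 0ℤ → j ≡ 0ℤ
+n*j≡0⇒j≡0 {g} j 0<g g*j≡0 with i*j≡0⇒i≡0∨j≡0 (+ g) g*j≡0
... | inj₁ g≡0 = ⊥-elim (ℕ.<⇒≢ 0<g (sym (+-injective g≡0)))
... | inj₂ j≡0 = j≡0

ind-*-yes : ∀ {P : Set} (d : Dec P) {a} → P → ind d * a ≡ a
ind-*-yes (yes _) p = *-identityˡ _
ind-*-yes (no ¬p) p = ⊥-elim (¬p p)

sumFin-cong : ∀ m {f g : Fin m → ℤ} → (∀ x → f x ≡ g x) → sumFin m f ≡ sumFin m g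
sumFin-cong ℕ.zero    f≗g = refl
sumFin-cong (ℕ.suc m) f≗g = cong₂ _+_ (f≗g zero) (sumFin-cong m (λ x → f≗g (suc x)))

sumFin-*ˡ : ∀ m a (f : Fin m → ℤ) → sumFin m (λ x → a * f x) ≡ a * sumFin m f
sumFin-*ˡ ℕ.zero    a f = sym (*-zeroʳ a)
sumFin-*ˡ (ℕ.suc m) a f = begin
  a * f zero + sumFin m (λ x → a * f (suc x)) ≡⟨ cong (_+_ (a * f zero)) (sumFin-*ˡ m a _) ⟩
  a * f zero + a * sumFin m (λ x → f (suc x)) ≡⟨ *-distribˡ-+ a (f zero) _ ⟨
  a * sumFin (ℕ.suc m) f                      ∎

sumFin-zero : ∀ m {f : Fin m → ℤ} → (∀ x → f x ≡ 0ℤ) → sumFin m f ≡ 0ℤ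
sumFin-zero ℕ.zero    f≗0 = refl
sumFin-zero (ℕ.suc m) f≗0 = cong₂ _+_ (f≗0 zero) (sumFin-zero m (λ x → f≗0 (suc x)))

sumFin-single : ∀ m (f : Fin m → ℤ) j → (∀ x → x ≢ j → f x ≡ 0ℤ) → sumFin m f ≡ f j
sumFin-single (ℕ.suc m) f zero    f≗0 = trans
  (cong (_+_ (f zero)) (sumFin-zero m (λ x → f≗0 (suc x) λ ())))
  (+-identityʳ (f zero))
sumFin-single (ℕ.suc m) f (suc j) f≗0 = trans
  (cong (_+ sumFin m (λ x → f (suc x))) (f≗0 zero λ ()))
  (trans (+-identityˡ _) (sumFin-single m _ j λ x x≢j → f≗0 (suc x) (x≢j ∘ Fin.suc-injective)))

sumFin-nonPos : ∀ m (f : Fin m → ℤ) → (∀ x → f x ≤ 0ℤ) → sumFin m f ≤ 0ℤ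
sumFin-nonPos ℕ.zero    f f≤0 = ≤-refl
sumFin-nonPos (ℕ.suc m) f f≤0 = +-mono-≤ (f≤0 zero) (sumFin-nonPos m _ λ x → f≤0 (suc x))

sumFin-nonPos-zero : ∀ m (f : Fin m → ℤ) → (∀ x → f x ≤ 0ℤ) → sumFin m f ≡ 0ℤ →
                     ∀ x → f x ≡ 0ℤ
sumFin-nonPos-zero (ℕ.suc m) f f≤0 Σf≡0 x = go x
  where
  tail≤0 : sumFin m (λ x → f (suc x)) ≤ 0ℤ
  tail≤0 = sumFin-nonPos m _ λ x → f≤0 (suc x)
  head≡0 : f zero ≡ 0ℤ
  head≡0 = +-nonPos-zeroˡ (f≤0 zero) tail≤0 Σf≡0
  tail≡0 : sumFin m (λ x → f (suc x)) ≡ 0ℤ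
  tail≡0 = trans (sym (trans (cong (_+ sumFin m (λ x → f (suc x))) head≡0) (+-identityˡ _))) Σf≡0
  go : ∀ x → f x ≡ 0ℤ
  go zero    = head≡0
  go (suc x) = sumFin-nonPos-zero m _ (λ x → f≤0 (suc x)) tail≡0 x

module _ {n m : ℕ} (φ : Fin m → Fin n) (i : Fin n) where

  sumFiber-cong : ∀ {f g : Fin m → ℤ} → (∀ x → φ x ≡ i → f x ≡ g x) →
                  sumFiber φ i f ≡ sumFiber φ i g
  sumFiber-cong {f} {g} f≗g = sumFin-cong m term
    where
    term : ∀ x → ind (φ x ≟ i) * f x ≡ ind (φ x ≟ i) * g x
    term x with φ x ≟ i
    ... | yes φx≡i = cong (+ 1 *_) (f≗g x φx≡i)
    ... | no  _    = refl

  sumFiber-*ˡ : ∀ a (f : Fin m → ℤ) → sumFiber φ i (λ x → a * f x) ≡ a * sumFiber φ i f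
  sumFiber-*ˡ a f = begin
    sumFin m (λ x → ind (φ x ≟ i) * (a * f x)) ≡⟨ sumFin-cong m (λ x → x∙yz≈y∙xz (ind (φ x ≟ i)) a (f x)) ⟩
    sumFin m (λ x → a * (ind (φ x ≟ i) * f x)) ≡⟨ sumFin-*ˡ m a _ ⟩
    a * sumFiber φ i f                         ∎

  sumFiber-single : ∀ (f : Fin m → ℤ) {j} → φ j ≡ i → (∀ x → φ x ≡ i → x ≢ j → f x ≡ 0ℤ) →
                    sumFiber φ i f ≡ f j
  sumFiber-single f {j} φj≡i f≗0 =
    trans (sumFin-single m _ j term) (ind-*-yes (φ j ≟ i) φj≡i)
    where
    term : ∀ x → x ≢ j → ind (φ x ≟ i) * f x ≡ 0ℤ
    term x x≢j with φ x ≟ i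
    ... | yes φx≡i = trans (*-identityˡ (f x)) (f≗0 x φx≡i x≢j)
    ... | no  _    = refl

  sumFiber-nonPos-zero : ∀ (f : Fin m → ℤ) → (∀ x → φ x ≡ i → f x ≤ 0ℤ) →
                         sumFiber φ i f ≡ 0ℤ → ∀ x → φ x ≡ i → f x ≡ 0ℤ
  sumFiber-nonPos-zero f f≤0 Σf≡0 x φx≡i =
    trans (sym (ind-*-yes (φ x ≟ i) φx≡i)) (sumFin-nonPos-zero m _ term≤0 Σf≡0 x)
    where
    term≤0 : ∀ x → ind (φ x ≟ i) * f x ≤ 0ℤ
    term≤0 x with φ x ≟ i
    ... | yes φx≡i = subst (_≤ 0ℤ) (sym (*-identityˡ (f x))) (f≤0 x φx≡i)
    ... | no  _    = ≤-refl

module _ {n : ℕ} (C c : Fin n → Fin n → ℤ) (i : Fin n) (k l : ℤ) where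

  A-self : A C c i k i l ≡ ind (l ℤ.≟ k) + ind (l ℤ.≟ (k + + 1))
  A-self with i ≟ i
  ... | yes _   = refl
  ... | no  i≢i = ⊥-elim (i≢i refl)

  A-other : ∀ {j} → j ≢ i → A C c i k j l ≡ ind (l ℤ.≟ (k + c j i)) * C j i
  A-other {j} j≢i with j ≟ i
  ... | yes j≡i = ⊥-elim (j≢i j≡i)
  ... | no  _   = refl

module _ {n m : ℕ} (C c : Fin n → Fin n → ℤ) (Ĉ ĉ : Fin m → Fin m → ℤ)
         (φ : Fin m → Fin n) (γ : Fin n → ℕ) where

  v-A-onFiber : (∀ i₁' i₂' → i₁' ≢ i₂' → φ i₁' ≡ φ i₂' → Ĉ i₁' i₂' ≡ 0ℤ) →
                ∀ i k j' l → φ j' ≡ i → v φ γ (A C c i k) j' l ≡ fiberProdA φ γ Ĉ ĉ i k j' l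
  v-A-onFiber fiber-unlinked .(φ j') k j' l refl = begin
    + γ (φ j') * A C c (φ j') k (φ j') l ≡⟨ cong (+ γ (φ j') *_) A-self-lifts ⟩
    + γ (φ j') * A Ĉ ĉ j' k j' l         ≡⟨ sumFiber-single φ (φ j') _ refl others-vanish ⟨
    fiberProdA φ γ Ĉ ĉ (φ j') k j' l     ∎
    where
    A-self-lifts : A C c (φ j') k (φ j') l ≡ A Ĉ ĉ j' k j' l
    A-self-lifts = trans (A-self C c (φ j') k l) (sym (A-self Ĉ ĉ j' k l))
    others-vanish : ∀ x → φ x ≡ φ j' → x ≢ j' → + γ (φ j') * A Ĉ ĉ x k j' l ≡ 0ℤ
    others-vanish x φx≡φj' x≢j' = begin
      + γ (φ j') * A Ĉ ĉ x k j' l                          ≡⟨ cong (+ γ (φ j') *_) (A-other Ĉ ĉ x k l (x≢j' ∘ sym)) ⟩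
      + γ (φ j') * (ind (l ℤ.≟ (k + ĉ j' x)) * Ĉ j' x)     ≡⟨ cong (λ t → + γ (φ j') * (ind (l ℤ.≟ (k + ĉ j' x)) * t)) Ĉj'x≡0 ⟩
      + γ (φ j') * (ind (l ℤ.≟ (k + ĉ j' x)) * 0ℤ)         ≡⟨ cong (+ γ (φ j') *_) (*-zeroʳ (ind (l ℤ.≟ (k + ĉ j' x)))) ⟩
      + γ (φ j') * 0ℤ                                      ≡⟨ *-zeroʳ (+ γ (φ j')) ⟩
      0ℤ                                                   ∎
      where
      Ĉj'x≡0 : Ĉ j' x ≡ 0ℤ
      Ĉj'x≡0 = fiber-unlinked j' x (x≢j' ∘ sym) (sym φx≡φj')

  -- weights is φ̃(α_i) = Σ_{i' ∈ φ⁻¹(i)} γ_i α̂_{i'} read off at Λ̂_{j'}.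
  module _ (Ĉ-GCM : IsGCM Ĉ) (γ>0 : ∀ i → 0 < γ i)
           (weights : ∀ i j' → + γ (φ j') * C (φ j') i ≡ sumFiber φ i (λ x → + γ i * Ĉ j' x))
           (compatible : ∀ i' j' → i' ∼[ Ĉ ] j' → φ i' ∼[ C ] φ j' → ĉ i' j' ≡ c (φ i') (φ j'))
           {i : Fin n} {j' : Fin m} (φj'≢i : φ j' ≢ i) where

    private
      j'≢fiber : ∀ {x} → φ x ≡ i → j' ≢ x
      j'≢fiber φx≡i j'≡x = φj'≢i (trans (cong φ j'≡x) φx≡i)

    Ĉ≢0⇒C≢0 : ∀ {x} → φ x ≡ i → Ĉ j' x ≢ 0ℤ → C (φ j') i ≢ 0ℤ
    Ĉ≢0⇒C≢0 {x} φx≡i Ĉj'x≢0 Cφj'i≡0 =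
      Ĉj'x≢0 (+n*j≡0⇒j≡0 (Ĉ j' x) (γ>0 i) (sumFiber-nonPos-zero φ i _ terms≤0 sum≡0 x φx≡i))
      where
      sum≡0 : sumFiber φ i (λ y → + γ i * Ĉ j' y) ≡ 0ℤ
      sum≡0 = begin
        sumFiber φ i (λ y → + γ i * Ĉ j' y) ≡⟨ weights i j' ⟨
        + γ (φ j') * C (φ j') i             ≡⟨ cong (+ γ (φ j') *_) Cφj'i≡0 ⟩
        + γ (φ j') * 0ℤ                     ≡⟨ *-zeroʳ (+ γ (φ j')) ⟩
        0ℤ                                  ∎
      terms≤0 : ∀ y → φ y ≡ i → + γ i * Ĉ j' y ≤ 0ℤ
      terms≤0 y φy≡i = subst (+ γ i * Ĉ j' y ≤_) (*-zeroʳ (+ γ i))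
        (*-monoˡ-≤-nonNeg (+ γ i) (IsGCM.offdiag Ĉ-GCM j' y (j'≢fiber φy≡i)))

    φ-preserves-∼ : ∀ {x} → φ x ≡ i → j' ∼[ Ĉ ] x → φ j' ∼[ C ] φ x
    φ-preserves-∼ φx≡i (_ , Ĉj'x≢0) =
      subst (φ j' ∼[ C ]_) (sym φx≡i) (φj'≢i , Ĉ≢0⇒C≢0 φx≡i Ĉj'x≢0)

    A-offFiber : ∀ k l {x} → φ x ≡ i → A Ĉ ĉ x k j' l ≡ ind (l ℤ.≟ (k + c (φ j') i)) * Ĉ j' x
    A-offFiber k l {x} φx≡i = trans (A-other Ĉ ĉ x k l (j'≢fiber φx≡i)) shift
      where
      shift : ind (l ℤ.≟ (k + ĉ j' x)) * Ĉ j' x ≡ ind (l ℤ.≟ (k + c (φ j') i)) * Ĉ j' x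
      shift with Ĉ j' x ℤ.≟ 0ℤ
      ... | yes Ĉj'x≡0 rewrite Ĉj'x≡0 =
        trans (*-zeroʳ (ind (l ℤ.≟ (k + ĉ j' x)))) (sym (*-zeroʳ (ind (l ℤ.≟ (k + c (φ j') i)))))
      ... | no  Ĉj'x≢0 = cong (λ t → ind (l ℤ.≟ (k + t)) * Ĉ j' x) ĉj'x≡c
        where
        ĉj'x≡c : ĉ j' x ≡ c (φ j') i
        ĉj'x≡c = trans (compatible j' x j'∼x (φ-preserves-∼ φx≡i j'∼x)) (cong (c (φ j')) φx≡i)
          where
          j'∼x : j' ∼[ Ĉ ] x
          j'∼x = j'≢fiber φx≡i , Ĉj'x≢0

    v-A-offFiber : ∀ k l → v φ γ (A C c i k) j' l ≡ fiberProdA φ γ Ĉ ĉ i k j' l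
    v-A-offFiber k l = begin
      + γ (φ j') * A C c i k (φ j') l              ≡⟨ cong (+ γ (φ j') *_) (A-other C c i k l φj'≢i) ⟩
      + γ (φ j') * (δ * C (φ j') i)                ≡⟨ x∙yz≈y∙xz (+ γ (φ j')) δ (C (φ j') i) ⟩
      δ * (+ γ (φ j') * C (φ j') i)                ≡⟨ cong (δ *_) (weights i j') ⟩
      δ * sumFiber φ i (λ x → + γ i * Ĉ j' x)      ≡⟨ sumFiber-*ˡ φ i δ _ ⟨
      sumFiber φ i (λ x → δ * (+ γ i * Ĉ j' x))    ≡⟨ sumFiber-cong φ i term ⟩
      sumFiber φ i (λ x → + γ i * A Ĉ ĉ x k j' l)  ∎
      where
      δ : ℤ
      δ = ind (l ℤ.≟ (k + c (φ j') i))
      term : ∀ x → φ x ≡ i → δ * (+ γ i * Ĉ j' x) ≡ + γ i * A Ĉ ĉ x k j' l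
      term x φx≡i = trans (x∙yz≈y∙xz δ (+ γ i) (Ĉ j' x))
                          (cong (+ γ i *_) (sym (A-offFiber k l φx≡i)))

lemma4p1 : (n m : ℕ) (C c : Fin n → Fin n → ℤ) (Ĉ ĉ : Fin m → Fin m → ℤ)
    (φ : Fin m → Fin n) (γ : Fin n → ℕ) →
    IsSymGCM C → IsSymGCM Ĉ →
    (∀ i → ∃ λ i' → φ i' ≡ i) →
    (∀ i₁' i₂' → i₁' ≢ i₂' → φ i₁' ≡ φ i₂' → Ĉ i₁' i₂' ≡ + 0) →
    (∀ i → 0 < γ i) →
    IsArray c → IsArray ĉ →
    (∀ i' j' → i' ∼[ Ĉ ] j' → φ i' ∼[ C ] φ j' → ĉ i' j' ≡ c (φ i') (φ j')) →
    (∀ i j' → φ̃ φ γ (α C i) j' ≡ sumFiber φ i (λ i' → + γ i * α Ĉ i' j')) →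
    ∀ (i : Fin n) (k : ℕ) → v φ γ (A C c i (+ k)) ≈M fiberProdA φ γ Ĉ ĉ i (+ k)
lemma4p1 n m C c Ĉ ĉ φ γ _ (Ĉ-GCM , _) _ fiber-unlinked γ>0 _ _ compatible weights i k j' l =
  byFiber (φ j' ≟ i)
  where
  byFiber : Dec (φ j' ≡ i) → v φ γ (A C c i (+ k)) j' l ≡ fiberProdA φ γ Ĉ ĉ i (+ k) j' l
  byFiber (yes φj'≡i) = v-A-onFiber C c Ĉ ĉ φ γ fiber-unlinked i (+ k) j' l φj'≡i
  byFiber (no  φj'≢i) = v-A-offFiber C c Ĉ ĉ φ γ Ĉ-GCM γ>0 weights compatible φj'≢i (+ k) l
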